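{- Let $K$ be a valued field and $c=(c_0,\dots,c_{n-1})$ a tuple in $\mathrm{Cut}$. For every $a=(a_{i,j})\in B_n$, we have $a\Lambda_c=\Lambda_c$ if and only if $v(a_{i,i})\in\Delta_{c_i}$ for all $i<n$ and $a_{i,j}\in(I_{c_i}:I_{c_j})$ for all $i<j<n$.
   Context: $(C_c)_{c\in\mathrm{Cut}}$ is a fixed ind-definable family of cuts (upward closed subsets) of the value group $\Gamma$; $I_c=\{x\in K:v(x)\in C_c\}$, an $\mathcal O$-submodule of $K$; $\Delta_c=\{\gamma\in\Gamma:\gamma+C_c=C_c\}$, a convex subgroup. $B_n$ is the group of invertible upper triangular $n\times n$ matrices over $K$, $\Lambda_c=\sum_iI_{c_i}e_i\subseteq K^n$ with $(e_i)$ the canonical basis. For $\mathcal O$-submodules $I,J\le K$, $(I:J)=\{x\in K:xJ\subseteq I\}$. -}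

module Defs where

open import Level using (0ℓ)
open import Data.Nat using (ℕ)
open import Data.Fin using (Fin; _<_) renaming (_≟_ to _≟F_)
open import Data.Product using (Σ; ∃; _×_; _,_)
open import Data.Sum using (_⊎_)
open import Relation.Nullary using (¬_; yes; no)
open import Data.Unit using (⊤)
open import Data.Empty using (⊥)
import Data.Fin as Fin
open import Relation.Binary.PropositionalEquality using (_≡_)
open import Relation.Binary.Structures using (IsTotalOrder)
open import Algebra.Bundles using (CommutativeRing)
open import Algebra.Structures using (IsAbelianGroup)

record OrderedAbelianGroup : Set₁ where
  infixl 6 _+_
  infix 4 _≤_
  field
    Carrier        : Set
    _+_            : Carrier → Carrier → Carrier
    0#             : Carrier
    -_             : Carrier → Carrier
    _≤_            : Carrier → Carrier → Set
    isAbelianGroup : IsAbelianGroup _≡_ _+_ 0# -_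
    isTotalOrder   : IsTotalOrder _≡_ _≤_
    +-mono-≤       : ∀ {x y} z → x ≤ y → x + z ≤ y + z

data ∞ext (G : Set) : Set where
  fin : G → ∞ext G
  ∞   : ∞ext G

module _ (Γ : OrderedAbelianGroup) where
  open OrderedAbelianGroup Γ

  _+∞_ : ∞ext Carrier → ∞ext Carrier → ∞ext Carrier
  fin x +∞ fin y = fin (x + y)
  fin x +∞ ∞     = ∞
  ∞     +∞ _     = ∞

  data _≤∞_ : ∞ext Carrier → ∞ext Carrier → Set where
    fin≤fin : ∀ {x y} → x ≤ y → fin x ≤∞ fin y
    _≤∞∞    : ∀ u → u ≤∞ ∞

record ValuedField : Set₁ where
  field
    ringK : CommutativeRing 0ℓ 0ℓ
    Γ     : OrderedAbelianGroup
  open CommutativeRing ringK public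
  open OrderedAbelianGroup Γ public
    renaming (Carrier to ΓC; _+_ to _+Γ_; 0# to 0Γ; -_ to -Γ_; _≤_ to _≤Γ_;
              isAbelianGroup to Γ-isAbelianGroup; isTotalOrder to Γ-isTotalOrder;
              +-mono-≤ to Γ-+-mono-≤)
  field
    1≉0      : ¬ (1# ≈ 0#)
    inverse  : ∀ x → ¬ (x ≈ 0#) → ∃ λ y → x * y ≈ 1#
    v        : Carrier → ∞ext ΓC
    v-cong   : ∀ {x y} → x ≈ y → v x ≡ v y
    v-∞      : ∀ x → v x ≡ ∞ → x ≈ 0#
    v-0      : v 0# ≡ ∞
    v-mult   : ∀ x y → v (x * y) ≡ _+∞_ Γ (v x) (v y)
    v-ultra  : ∀ x y → _≤∞_ Γ (v x) (v (x + y)) ⊎ _≤∞_ Γ (v y) (v (x + y))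
    v-onto   : ∀ γ → ∃ λ x → v x ≡ fin γ

-- Everything below is relative to a valued field K and a family of cuts
-- (C c)_{c : Cut} of Γ (upward closed subsets).

module _ (K : ValuedField) where
  open ValuedField K

  UpwardClosed : (ΓC → Set) → Set
  UpwardClosed C = ∀ {γ δ} → γ ≤Γ δ → C γ → C δ

  -- membership of an element of Γ ∪ {∞} in a cut (∞ lies in every cut,
  -- so that 0 ∈ I_c)
  _∈∞_ : ∞ext ΓC → (ΓC → Set) → Set
  fin γ ∈∞ C = C γ
  ∞     ∈∞ C = ⊤

  I : (ΓC → Set) → Carrier → Set
  I C x = v x ∈∞ C

  -- Δ_c = { γ ∈ Γ : γ + C_c = C_c }  (equality of subsets of Γ)
  Δ : (ΓC → Set) → ΓC → Set
  Δ C γ = (∀ δ → C δ → C (γ +Γ δ)) × (∀ δ → C δ → ∃ λ δ' → C δ' × δ ≡ γ +Γ δ')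

  _∈Δ_ : ∞ext ΓC → (ΓC → Set) → Set
  fin γ ∈Δ C = Δ C γ
  ∞     ∈Δ C = ⊥

  _∶_ : (Carrier → Set) → (Carrier → Set) → Carrier → Set
  (P ∶ Q) x = ∀ y → Q y → P (x * y)

  Mat : ℕ → Set
  Mat n = Fin n → Fin n → Carrier

  Vect : ℕ → Set
  Vect n = Fin n → Carrier

  ∑ : ∀ {n} → (Fin n → Carrier) → Carrier
  ∑ {ℕ.zero}  f = 0#
  ∑ {ℕ.suc n} f = f Fin.zero + ∑ (λ i → f (Fin.suc i))

  _·_ : ∀ {n} → Mat n → Mat n → Mat n
  (a · b) i j = ∑ λ k → a i k * b k j

  _▸_ : ∀ {n} → Mat n → Vect n → Vect n
  (a ▸ x) i = ∑ λ k → a i k * x k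

  idMat : ∀ {n} → Mat n
  idMat i j with i ≟F j
  ... | yes _ = 1#
  ... | no  _ = 0#

  _≈M_ : ∀ {n} → Mat n → Mat n → Set
  a ≈M b = ∀ i j → a i j ≈ b i j

  _≈V_ : ∀ {n} → Vect n → Vect n → Set
  x ≈V y = ∀ i → x i ≈ y i

  InB : ∀ n → Mat n → Set
  InB n a = (∀ i j → j < i → a i j ≈ 0#)
          × (∃ λ b → ((a · b) ≈M idMat) × ((b · a) ≈M idMat))

  Λ : ∀ {n} → (Fin n → (ΓC → Set)) → Vect n → Set
  Λ c x = ∀ i → I (c i) (x i)

  -- a Λ_c = Λ_c  (equality of subsets of Kⁿ)
  ActEq : ∀ {n} → Mat n → (Fin n → (ΓC → Set)) → Set
  ActEq a c = (∀ x → Λ c x → Λ c (a ▸ x))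
            × (∀ y → Λ c y → ∃ λ x → Λ c x × (a ▸ x) ≈V y)

-- A matrix a ∈ Bₙ with a Λ ⊆ Λ has every entry a i j in (I (c i) : I (c j)), by testing a on the
-- vectors t e_j. Conversely these colon conditions give a Λ ⊆ Λ term by term, since each I (c i) is
-- closed under sums. The diagonal condition v (a i i) ∈ Δ (c i) is what makes the inclusion an
-- equality: it lets us divide by a i i while staying in I (c i), so a x = y can be solved in Λ by
-- back substitution; conversely, since the left inverse of a is upper triangular with diagonal
-- entries a i i ⁻¹, solving a x = t e_i gives x i = a i i ⁻¹ t ∈ I (c i), whence C (c i) ⊆ v (a i i) + C (c i).
module Submission where

open import Level using (0ℓ)
open import Data.Nat using (ℕ; zero; suc; _≤_; s≤s; z≤n)
import Data.Nat.Properties as ℕₚ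
open import Data.Fin using (Fin; _<_; toℕ) renaming (zero to 0F; suc to sucF; _≟_ to _≟F_)
open import Data.Fin.Properties using (<-cmp; suc-injective)
open import Data.Fin.Induction using (<-wellFounded)
open import Induction.WellFounded using (module All)
open import Data.Vec.Functional using (_∷_)
open import Data.Product using (∃; _×_; _,_; proj₁; proj₂)
open import Data.Sum using (inj₁; inj₂)
open import Data.Unit using (tt)
open import Data.Empty using (⊥-elim)
open import Function using (_∘_)
open import Function.Bundles using (_⇔_; mk⇔)
open import Relation.Nullary using (¬_; yes; no)
open import Relation.Binary.Definitions using (tri<; tri≈; tri>)
open import Relation.Binary.PropositionalEquality as P using (_≡_)
open import Algebra.Bundles using (AbelianGroup)
open import Relation.Binary.Structures using (IsTotalOrder)
import Defs as D
open D using (ValuedField; ∞ext; fin; ∞; fin≤fin; _≤∞∞)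

module Stabiliser (K : ValuedField) where
  open ValuedField K
  open import Relation.Binary.Reasoning.Setoid setoid
  open import Algebra.Properties.Semiring.Sum semiring
    using (sum; sum-cong-≋; sum-cong-≗; sum-replicate-zero; ∑-comm; *-distribˡ-sum; *-distribʳ-sum)
  open import Algebra.Properties.Ring ring using (-1*x≈-x; -‿involutive)

  ΓGroup : AbelianGroup 0ℓ 0ℓ
  ΓGroup = record { isAbelianGroup = Γ-isAbelianGroup }

  open AbelianGroup ΓGroup using () renaming (assoc to +Γ-assoc; comm to +Γ-comm; identityˡ to +Γ-identityˡ)
  open import Algebra.Properties.Group (AbelianGroup.group ΓGroup) using (identityˡ-unique)
  module Γ≤ = IsTotalOrder Γ-isTotalOrder

  UpwardClosed : (ΓC → Set) → Set
  UpwardClosed = D.UpwardClosed K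

  _∈∞_ : ∞ext ΓC → (ΓC → Set) → Set
  _∈∞_ = D._∈∞_ K

  I : (ΓC → Set) → Carrier → Set
  I = D.I K

  _∈Δ_ : ∞ext ΓC → (ΓC → Set) → Set
  _∈Δ_ = D._∈Δ_ K

  _∶_ : (Carrier → Set) → (Carrier → Set) → Carrier → Set
  _∶_ = D._∶_ K

  _+v_ : ∞ext ΓC → ∞ext ΓC → ∞ext ΓC
  _+v_ = D._+∞_ Γ

  _≤v_ : ∞ext ΓC → ∞ext ΓC → Set
  _≤v_ = D._≤∞_ Γ

  Vect Mat : ℕ → Set
  Vect = D.Vect K
  Mat = D.Mat K

  ∑ : ∀ {n} → Vect n → Carrier
  ∑ = D.∑ K

  _·_ : ∀ {n} → Mat n → Mat n → Mat n
  _·_ = D._·_ K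

  _▸_ : ∀ {n} → Mat n → Vect n → Vect n
  _▸_ = D._▸_ K

  idMat : ∀ {n} → Mat n
  idMat = D.idMat K

  _≈M_ : ∀ {n} → Mat n → Mat n → Set
  _≈M_ = D._≈M_ K

  _≈V_ : ∀ {n} → Vect n → Vect n → Set
  _≈V_ = D._≈V_ K

  Λ : ∀ {n} → (Fin n → ΓC → Set) → Vect n → Set
  Λ = D.Λ K

  ActEq : ∀ {n} → Mat n → (Fin n → ΓC → Set) → Set
  ActEq = D.ActEq K

  InB : ∀ n → Mat n → Set
  InB = D.InB K

  ∑≡sum : ∀ {n} (f : Vect n) → ∑ f ≡ sum f
  ∑≡sum {zero}  f = P.refl
  ∑≡sum {suc n} f = P.cong (f 0F +_) (∑≡sum (f ∘ sucF))

  ∑-cong : ∀ {n} {f g : Vect n} → (∀ k → f k ≈ g k) → ∑ f ≈ ∑ g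
  ∑-cong {f = f} {g} f≈g = begin
    ∑ f   ≡⟨ ∑≡sum f ⟩
    sum f ≈⟨ sum-cong-≋ f≈g ⟩
    sum g ≡⟨ ∑≡sum g ⟨
    ∑ g   ∎

  ∑-zero : ∀ {n} {f : Vect n} → (∀ k → f k ≈ 0#) → ∑ f ≈ 0#
  ∑-zero {n} {f} f≈0 = begin
    ∑ f   ≡⟨ ∑≡sum f ⟩
    sum f ≈⟨ sum-cong-≋ f≈0 ⟩
    sum {n} (λ _ → 0#) ≈⟨ sum-replicate-zero n ⟩
    0#    ∎

  ∑-single : ∀ {n} (f : Vect n) j → (∀ k → ¬ k ≡ j → f k ≈ 0#) → ∑ f ≈ f j
  ∑-single f 0F       f≈0 = trans (+-congˡ (∑-zero (λ k → f≈0 (sucF k) λ ()))) (+-identityʳ _)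
  ∑-single f (sucF j) f≈0 = trans (+-cong (f≈0 0F λ ()) (∑-single (f ∘ sucF) j f∘suc≈0)) (+-identityˡ _)
    where
    f∘suc≈0 : ∀ k → ¬ k ≡ j → f (sucF k) ≈ 0#
    f∘suc≈0 k k≢j = f≈0 (sucF k) (k≢j ∘ suc-injective)

  *-distribˡ-∑ : ∀ {n} x (f : Vect n) → x * ∑ f ≈ ∑ (λ k → x * f k)
  *-distribˡ-∑ x f = begin
    x * ∑ f                ≡⟨ P.cong (x *_) (∑≡sum f) ⟩
    x * sum f              ≈⟨ *-distribˡ-sum x f ⟩
    sum (λ k → x * f k)    ≡⟨ ∑≡sum (λ k → x * f k) ⟨
    ∑ (λ k → x * f k)      ∎

  *-distribʳ-∑ : ∀ {n} x (f : Vect n) → ∑ f * x ≈ ∑ (λ k → f k * x)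
  *-distribʳ-∑ x f = begin
    ∑ f * x                ≡⟨ P.cong (_* x) (∑≡sum f) ⟩
    sum f * x              ≈⟨ *-distribʳ-sum x f ⟩
    sum (λ k → f k * x)    ≡⟨ ∑≡sum (λ k → f k * x) ⟨
    ∑ (λ k → f k * x)      ∎

  ∑-swap : ∀ {m n} (f : Fin m → Fin n → Carrier) →
           ∑ (λ k → ∑ (λ l → f k l)) ≈ ∑ (λ l → ∑ (λ k → f k l))
  ∑-swap f = begin
    ∑ (λ k → ∑ (f k))                ≡⟨ ∑∑≡sumsum f ⟩
    sum (λ k → sum (f k))            ≈⟨ ∑-comm f ⟩
    sum (λ l → sum (λ k → f k l))    ≡⟨ ∑∑≡sumsum (λ l k → f k l) ⟨
    ∑ (λ l → ∑ (λ k → f k l))        ∎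
    where
    ∑∑≡sumsum : ∀ {m n} (g : Fin m → Fin n → Carrier) → ∑ (λ k → ∑ (g k)) ≡ sum (λ k → sum (g k))
    ∑∑≡sumsum g = P.trans (∑≡sum (λ k → ∑ (g k))) (sum-cong-≗ (λ k → ∑≡sum (g k)))

  ▸-congʳ : ∀ {n} (a : Mat n) {x y : Vect n} → x ≈V y → (a ▸ x) ≈V (a ▸ y)
  ▸-congʳ a x≈y i = ∑-cong (λ k → *-congˡ (x≈y k))

  ▸-congˡ : ∀ {n} {a b : Mat n} (x : Vect n) → a ≈M b → (a ▸ x) ≈V (b ▸ x)
  ▸-congˡ x a≈b i = ∑-cong (λ k → *-congʳ (a≈b i k))

  ▸-assoc : ∀ {n} (b a : Mat n) (x : Vect n) → (b ▸ (a ▸ x)) ≈V ((b · a) ▸ x)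
  ▸-assoc {n} b a x i = begin
    ∑ (λ k → b i k * ∑ (λ m → a k m * x m))
      ≈⟨ ∑-cong (λ k → *-distribˡ-∑ (b i k) (λ m → a k m * x m)) ⟩
    ∑ (λ k → ∑ (λ m → b i k * (a k m * x m)))
      ≈⟨ ∑-swap (λ k m → b i k * (a k m * x m)) ⟩
    ∑ (λ m → ∑ (λ k → b i k * (a k m * x m)))
      ≈⟨ ∑-cong {n} (λ m → ∑-cong {n} (λ k → sym (*-assoc (b i k) (a k m) (x m)))) ⟩
    ∑ (λ m → ∑ (λ k → (b i k * a k m) * x m))
      ≈⟨ ∑-cong (λ m → *-distribʳ-∑ (x m) (λ k → b i k * a k m)) ⟨
    ∑ (λ m → ∑ (λ k → b i k * a k m) * x m)
      ∎

  idMat-diag : ∀ {n} (i : Fin n) → idMat i i ≈ 1#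
  idMat-diag i with i ≟F i
  ... | yes _  = refl
  ... | no i≢i = ⊥-elim (i≢i P.refl)

  idMat-off : ∀ {n} (i j : Fin n) → ¬ i ≡ j → idMat i j ≈ 0#
  idMat-off i j i≢j with i ≟F j
  ... | yes i≡j = ⊥-elim (i≢j i≡j)
  ... | no _    = refl

  idMat-▸ : ∀ {n} (x : Vect n) → (idMat ▸ x) ≈V x
  idMat-▸ x i = begin
    ∑ (λ k → idMat i k * x k) ≈⟨ ∑-single _ i off-diagonal≈0 ⟩
    idMat i i * x i           ≈⟨ *-congʳ (idMat-diag i) ⟩
    1# * x i                  ≈⟨ *-identityˡ _ ⟩
    x i                       ∎
    where
    off-diagonal≈0 : ∀ k → ¬ k ≡ i → idMat i k * x k ≈ 0#
    off-diagonal≈0 k k≢i = trans (*-congʳ (idMat-off i k (k≢i ∘ P.sym))) (zeroˡ _)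

  leftInverse-solves : ∀ {n} {a b : Mat n} {x y : Vect n} →
                       (b · a) ≈M idMat → (a ▸ x) ≈V y → x ≈V (b ▸ y)
  leftInverse-solves {a = a} {b} {x} {y} ba≈1 ax≈y i = begin
    x i                 ≈⟨ idMat-▸ x i ⟨
    (idMat ▸ x) i       ≈⟨ ▸-congˡ x ba≈1 i ⟨
    ((b · a) ▸ x) i     ≈⟨ ▸-assoc b a x i ⟨
    (b ▸ (a ▸ x)) i     ≈⟨ ▸-congʳ b ax≈y i ⟩
    (b ▸ y) i           ∎

  basis : ∀ {n} → Fin n → Carrier → Vect n
  basis j t k with k ≟F j
  ... | yes _ = t
  ... | no _  = 0#

  ▸-basis : ∀ {n} (a : Mat n) i j t → (a ▸ basis j t) i ≈ a i j * t
  ▸-basis a i j t = trans (∑-single _ j a∙basis≈0) (*-congˡ basis-on)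
    where
    basis-on : basis j t j ≈ t
    basis-on with j ≟F j
    ... | yes _  = refl
    ... | no j≢j = ⊥-elim (j≢j P.refl)
    a∙basis≈0 : ∀ k → ¬ k ≡ j → a i k * basis j t k ≈ 0#
    a∙basis≈0 k k≢j with k ≟F j
    ... | yes k≡j = ⊥-elim (k≢j k≡j)
    ... | no _    = zeroʳ _

  UpperTriangular : ∀ {n} → Mat n → Set
  UpperTriangular a = ∀ i j → j < i → a i j ≈ 0#

  leftInverse-upperTriangular : ∀ {n} {a b : Mat n} → UpperTriangular a → (b · a) ≈M idMat →
                                ∀ j → (b j j * a j j ≈ 1#) × (∀ k → j < k → b k j ≈ 0#)
  leftInverse-upperTriangular {n} {a} {b} a-up ba≈1 = All.wfRec <-wellFounded 0ℓ Column column
    where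
    Column : Fin n → Set
    Column j = (b j j * a j j ≈ 1#) × (∀ k → j < k → b k j ≈ 0#)

    column : ∀ j → (∀ {m} → m < j → Column m) → Column j
    column j earlier = bⱼⱼaⱼⱼ≈1 , bₖⱼ≈0
      where
      -- terms with m > j vanish as a is upper triangular, those with m < j by the induction hypothesis
      ba-below : ∀ k → toℕ j ≤ toℕ k → (b · a) k j ≈ b k j * a j j
      ba-below k j≤k = ∑-single _ j term≈0
        where
        term≈0 : ∀ m → ¬ m ≡ j → b k m * a m j ≈ 0#
        term≈0 m m≢j with <-cmp m j
        ... | tri< m<j _ _ = trans (*-congʳ (proj₂ (earlier m<j) k (ℕₚ.<-≤-trans m<j j≤k))) (zeroˡ _)
        ... | tri≈ _ m≡j _ = ⊥-elim (m≢j m≡j)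
        ... | tri> _ _ j<m = trans (*-congˡ (a-up m j j<m)) (zeroʳ _)

      bⱼⱼaⱼⱼ≈1 : b j j * a j j ≈ 1#
      bⱼⱼaⱼⱼ≈1 = trans (sym (ba-below j ℕₚ.≤-refl)) (trans (ba≈1 j j) (idMat-diag j))

      bₖⱼ≈0 : ∀ k → j < k → b k j ≈ 0#
      bₖⱼ≈0 k j<k = begin
        b k j                    ≈⟨ *-identityʳ _ ⟨
        b k j * 1#               ≈⟨ *-congˡ (trans (*-comm _ _) bⱼⱼaⱼⱼ≈1) ⟨
        b k j * (a j j * b j j)  ≈⟨ *-assoc _ _ _ ⟨
        (b k j * a j j) * b j j  ≈⟨ *-congʳ (ba-below k (ℕₚ.<⇒≤ j<k)) ⟨
        (b · a) k j * b j j      ≈⟨ *-congʳ (trans (ba≈1 k j) (idMat-off k j k≢j)) ⟩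
        0# * b j j               ≈⟨ zeroˡ _ ⟩
        0#                       ∎
        where
        k≢j : ¬ k ≡ j
        k≢j P.refl = ℕₚ.<-irrefl P.refl j<k

  x+x≡0⇒x≡0 : ∀ γ → γ +Γ γ ≡ 0Γ → γ ≡ 0Γ
  x+x≡0⇒x≡0 γ γ+γ≡0 with Γ≤.total γ 0Γ
  ... | inj₁ γ≤0 = Γ≤.antisym γ≤0 (P.subst₂ _≤Γ_ γ+γ≡0 (+Γ-identityˡ γ) (Γ-+-mono-≤ γ γ≤0))
  ... | inj₂ 0≤γ = Γ≤.antisym (P.subst₂ _≤Γ_ (+Γ-identityˡ γ) γ+γ≡0 (Γ-+-mono-≤ γ 0≤γ)) 0≤γ

  α+ω≡0⇒ω+[α+ζ]≡ζ : ∀ {α ω} → α +Γ ω ≡ 0Γ → ∀ ζ → ω +Γ (α +Γ ζ) ≡ ζ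
  α+ω≡0⇒ω+[α+ζ]≡ζ {α} {ω} α+ω≡0 ζ = P.trans (P.sym (+Γ-assoc ω α ζ))
    (P.trans (P.cong (_+Γ ζ) (P.trans (+Γ-comm ω α) α+ω≡0)) (+Γ-identityˡ ζ))

  fin-injective : ∀ {γ δ : ΓC} → _≡_ {A = ∞ext ΓC} (fin γ) (fin δ) → γ ≡ δ
  fin-injective P.refl = P.refl

  v-finite : ∀ x → ¬ x ≈ 0# → ∃ λ γ → v x ≡ fin γ
  v-finite x x≉0 with v x in vx≡
  ... | fin γ = γ , P.refl
  ... | ∞     = ⊥-elim (x≉0 (v-∞ x vx≡))

  unit⇒≉0 : ∀ {x w} → x * w ≈ 1# → ¬ x ≈ 0#
  unit⇒≉0 {x} {w} xw≈1 x≈0 = 1≉0 (trans (sym xw≈1) (trans (*-congʳ x≈0) (zeroˡ w)))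

  v-1# : v 1# ≡ fin 0Γ
  v-1# = P.trans vγ (P.cong fin (identityˡ-unique γ γ (P.sym γ≡γ+γ)))
    where
    γ : ΓC
    γ = proj₁ (v-finite 1# 1≉0)
    vγ : v 1# ≡ fin γ
    vγ = proj₂ (v-finite 1# 1≉0)
    γ≡γ+γ : γ ≡ γ +Γ γ
    γ≡γ+γ = fin-injective (P.trans (P.sym vγ)
              (P.trans (v-cong (sym (*-identityˡ 1#))) (P.trans (v-mult 1# 1#) (P.cong₂ _+v_ vγ vγ))))

  v-*-fin : ∀ {x y α β} → v x ≡ fin α → v y ≡ fin β → v (x * y) ≡ fin (α +Γ β)
  v-*-fin {x} {y} vx vy = P.trans (v-mult x y) (P.cong₂ _+v_ vx vy)

  v-inverse : ∀ {x w α ω} → x * w ≈ 1# → v x ≡ fin α → v w ≡ fin ω → α +Γ ω ≡ 0Γ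
  v-inverse xw≈1 vx vw = fin-injective (P.trans (P.sym (v-*-fin vx vw)) (P.trans (v-cong xw≈1) v-1#))

  v-[-1#] : v (- 1#) ≡ fin 0Γ
  v-[-1#] = P.trans vγ (P.cong fin (x+x≡0⇒x≡0 γ (v-inverse [-1]² vγ vγ)))
    where
    [-1]² : (- 1#) * (- 1#) ≈ 1#
    [-1]² = trans (-1*x≈-x (- 1#)) (-‿involutive 1#)
    γ : ΓC
    γ = proj₁ (v-finite (- 1#) (unit⇒≉0 [-1]²))
    vγ : v (- 1#) ≡ fin γ
    vγ = proj₂ (v-finite (- 1#) (unit⇒≉0 [-1]²))

  v-neg : ∀ x → v (- x) ≡ v x
  v-neg x = P.trans (v-cong (sym (-1*x≈-x x)))
    (P.trans (v-mult (- 1#) x) (P.trans (P.cong (_+v v x) v-[-1#]) (0+u≡u (v x))))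
    where
    0+u≡u : ∀ u → fin 0Γ +v u ≡ u
    0+u≡u (fin γ) = P.cong fin (+Γ-identityˡ γ)
    0+u≡u ∞       = P.refl

  ∈∞-mono : ∀ {C} → UpwardClosed C → ∀ {u w} → u ≤v w → u ∈∞ C → w ∈∞ C
  ∈∞-mono C-up (fin≤fin γ≤δ) γ∈C = C-up γ≤δ γ∈C
  ∈∞-mono C-up (_ ≤∞∞)       _   = tt

  I-cong : ∀ {C x y} → x ≈ y → I C x → I C y
  I-cong {C} x≈y = P.subst (_∈∞ C) (v-cong x≈y)

  I-0# : ∀ {C} → I C 0#
  I-0# {C} = P.subst (_∈∞ C) (P.sym v-0) tt

  I-+ : ∀ {C} → UpwardClosed C → ∀ {x y} → I C x → I C y → I C (x + y)
  I-+ C-up {x} {y} x∈I y∈I with v-ultra x y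
  ... | inj₁ vx≤ = ∈∞-mono C-up vx≤ x∈I
  ... | inj₂ vy≤ = ∈∞-mono C-up vy≤ y∈I

  I-neg : ∀ {C x} → I C x → I C (- x)
  I-neg {C} {x} = P.subst (_∈∞ C) (P.sym (v-neg x))

  I-∑ : ∀ {C} → UpwardClosed C → ∀ {n} (f : Vect n) → (∀ k → I C (f k)) → I C (∑ f)
  I-∑ C-up {zero}  f f∈I = I-0#
  I-∑ C-up {suc n} f f∈I = I-+ C-up (f∈I 0F) (I-∑ C-up (f ∘ sucF) (f∈I ∘ sucF))

  I-* : ∀ {C x y α} → v x ≡ fin α → (∀ δ → C δ → C (α +Γ δ)) → I C y → I C (x * y)
  I-* {C} {x} {y} {α} vx α+C⊆C y∈I =
    P.subst (_∈∞ C) (P.sym (P.trans (v-mult x y) (P.cong (_+v v y) vx))) (shift (v y) y∈I)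
    where
    shift : ∀ u → u ∈∞ C → (fin α +v u) ∈∞ C
    shift (fin δ) = α+C⊆C δ
    shift ∞       = λ _ → tt

  ∈Δ⇒≉0 : ∀ {C x} → v x ∈Δ C → ¬ x ≈ 0#
  ∈Δ⇒≉0 {C} {x} vx∈Δ x≈0 = P.subst (_∈Δ C) (P.trans (v-cong x≈0) v-0) vx∈Δ

  ∈Δ⇒[I∶I] : ∀ {C x} → v x ∈Δ C → (I C ∶ I C) x
  ∈Δ⇒[I∶I] {C} {x} vx∈Δ with v x in vx≡
  ... | fin α = λ y → I-* vx≡ (proj₁ vx∈Δ)

  ∈Δ⇒inverse∈[I∶I] : ∀ {C x w} → x * w ≈ 1# → v x ∈Δ C → (I C ∶ I C) w
  ∈Δ⇒inverse∈[I∶I] {C} {x} {w} xw≈1 vx∈Δ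
    with v x in vx≡ | v-finite w (unit⇒≉0 (trans (*-comm w x) xw≈1))
  ... | fin α | ω , vw≡ = λ y → I-* vw≡ ω+C⊆C
    where
    ω+C⊆C : ∀ δ → C δ → C (ω +Γ δ)
    ω+C⊆C δ δ∈C with proj₂ vx∈Δ δ δ∈C
    ... | δ′ , δ′∈C , δ≡α+δ′ =
      P.subst C (P.sym (P.trans (P.cong (ω +Γ_) δ≡α+δ′) (α+ω≡0⇒ω+[α+ζ]≡ζ (v-inverse xw≈1 vx≡ vw≡) δ′)))
        δ′∈C

  unit∈[I∶I]⇒∈Δ : ∀ {C x w} → w * x ≈ 1# → (I C ∶ I C) x → (I C ∶ I C) w → v x ∈Δ C
  unit∈[I∶I]⇒∈Δ {C} {x} {w} wx≈1 x∈[I∶I] w∈[I∶I]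
    with v-finite x (unit⇒≉0 (trans (*-comm x w) wx≈1)) | v-finite w (unit⇒≉0 wx≈1)
  ... | α , vx | ω , vw = P.subst (_∈Δ C) (P.sym vx) (α+C⊆C , C⊆α+C)
    where
    α+C⊆C : ∀ δ → C δ → C (α +Γ δ)
    α+C⊆C δ δ∈C with v-onto δ
    ... | t , vt = P.subst (_∈∞ C) (v-*-fin vx vt) (x∈[I∶I] t (P.subst (_∈∞ C) (P.sym vt) δ∈C))

    C⊆α+C : ∀ δ → C δ → ∃ λ δ′ → C δ′ × δ ≡ α +Γ δ′
    C⊆α+C δ δ∈C with v-onto δ
    ... | t , vt = ω +Γ δ , ω+δ∈C , P.sym (α+ω≡0⇒ω+[α+ζ]≡ζ (v-inverse wx≈1 vw vx) δ)
      where
      ω+δ∈C : C (ω +Γ δ)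
      ω+δ∈C = P.subst (_∈∞ C) (v-*-fin vw vt) (w∈[I∶I] t (P.subst (_∈∞ C) (P.sym vt) δ∈C))

  basis∈Λ : ∀ {n} (cs : Fin n → ΓC → Set) j {t} → I (cs j) t → Λ cs (basis j t)
  basis∈Λ cs j t∈I k with k ≟F j
  ... | yes P.refl = t∈I
  ... | no _       = I-0#

  MapsInto MapsOnto : ∀ {n} → (Fin n → ΓC → Set) → Mat n → Set
  MapsInto cs a = ∀ x → Λ cs x → Λ cs (a ▸ x)
  MapsOnto cs a = ∀ y → Λ cs y → ∃ λ x → Λ cs x × (a ▸ x) ≈V y

  EntrywiseStable : ∀ {n} → (Fin n → ΓC → Set) → Mat n → Set
  EntrywiseStable cs a = (∀ i → v (a i i) ∈Δ cs i) × (∀ i j → i < j → (I (cs i) ∶ I (cs j)) (a i j))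

  mapsInto⇒colon : ∀ {n} (cs : Fin n → ΓC → Set) {a : Mat n} → MapsInto cs a →
                   ∀ i j → (I (cs i) ∶ I (cs j)) (a i j)
  mapsInto⇒colon cs {a} aΛ⊆Λ i j t t∈I = I-cong (▸-basis a i j t) (aΛ⊆Λ (basis j t) (basis∈Λ cs j t∈I) i)

  leftInverse-mapsInto : ∀ {n} (cs : Fin n → ΓC → Set) {a b : Mat n} → (b · a) ≈M idMat →
                         MapsOnto cs a → MapsInto cs b
  leftInverse-mapsInto cs ba≈1 Λ⊆aΛ y y∈Λ with Λ⊆aΛ y y∈Λ
  ... | x , x∈Λ , ax≈y = λ i → I-cong (leftInverse-solves ba≈1 ax≈y i) (x∈Λ i)

  ActEq⇒diag∈Δ : ∀ {n} (cs : Fin n → ΓC → Set) {a b : Mat n} → UpperTriangular a → (b · a) ≈M idMat →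
                 ActEq a cs → ∀ i → v (a i i) ∈Δ cs i
  ActEq⇒diag∈Δ cs a-up ba≈1 (aΛ⊆Λ , Λ⊆aΛ) i =
    unit∈[I∶I]⇒∈Δ (proj₁ (leftInverse-upperTriangular a-up ba≈1 i))
      (mapsInto⇒colon cs aΛ⊆Λ i i) (mapsInto⇒colon cs (leftInverse-mapsInto cs ba≈1 Λ⊆aΛ) i i)

  EntrywiseStable⇒mapsInto : ∀ {n} (cs : Fin n → ΓC → Set) → (∀ i → UpwardClosed (cs i)) → (a : Mat n) →
                             UpperTriangular a → EntrywiseStable cs a → MapsInto cs a
  EntrywiseStable⇒mapsInto cs cs-up a a-up (diag∈Δ , colon) x x∈Λ i = I-∑ (cs-up i) _ term∈I
    where
    term∈I : ∀ k → I (cs i) (a i k * x k)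
    term∈I k with <-cmp i k
    ... | tri< i<k _ _      = colon i k i<k (x k) (x∈Λ k)
    ... | tri≈ _ P.refl _   = ∈Δ⇒[I∶I] (diag∈Δ i) (x k) (x∈Λ k)
    ... | tri> _ _ k<i      = I-cong (sym (trans (*-congʳ (a-up i k k<i)) (zeroˡ (x k)))) I-0#

  lowerRight : ∀ {n} → Mat (suc n) → Mat n
  lowerRight a i j = a (sucF i) (sucF j)

  UpperTriangular-lowerRight : ∀ {n} {a : Mat (suc n)} → UpperTriangular a → UpperTriangular (lowerRight a)
  UpperTriangular-lowerRight a-up i j j<i = a-up (sucF i) (sucF j) (s≤s j<i)

  EntrywiseStable-lowerRight : ∀ {n} {cs : Fin (suc n) → ΓC → Set} {a : Mat (suc n)} →
                               EntrywiseStable cs a → EntrywiseStable (cs ∘ sucF) (lowerRight a)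
  EntrywiseStable-lowerRight (diag∈Δ , colon) = diag∈Δ ∘ sucF , λ i j i<j → colon (sucF i) (sucF j) (s≤s i<j)

  solveFirstRow : ∀ {n} (cs : Fin (suc n) → ΓC → Set) → UpwardClosed (cs 0F) → (a : Mat (suc n)) →
                  UpperTriangular a → EntrywiseStable cs a → ∀ y → I (cs 0F) (y 0F) →
                  ∀ x′ → Λ (cs ∘ sucF) x′ → (lowerRight a ▸ x′) ≈V (y ∘ sucF) →
                  ∃ λ x → Λ cs x × (a ▸ x) ≈V y
  solveFirstRow cs C₀-up a a-up (diag∈Δ , colon) y y₀∈I x′ x′∈Λ ax′≈y′ =
    x₀ ∷ x′ , x∈Λ , ax≈y
    where
    a₀₀ w S x₀ : Carrier
    a₀₀ = a 0F 0F
    w = proj₁ (inverse a₀₀ (∈Δ⇒≉0 (diag∈Δ 0F)))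
    S = ∑ (λ k → a 0F (sucF k) * x′ k)
    x₀ = w * (y 0F + - S)
    a₀₀w≈1 : a₀₀ * w ≈ 1#
    a₀₀w≈1 = proj₂ (inverse a₀₀ (∈Δ⇒≉0 (diag∈Δ 0F)))

    x∈Λ : Λ cs (x₀ ∷ x′)
    x∈Λ 0F       = ∈Δ⇒inverse∈[I∶I] a₀₀w≈1 (diag∈Δ 0F) _ (I-+ C₀-up y₀∈I (I-neg S∈I))
      where
      S∈I : I (cs 0F) S
      S∈I = I-∑ C₀-up _ (λ k → colon 0F (sucF k) (s≤s z≤n) (x′ k) (x′∈Λ k))
    x∈Λ (sucF k) = x′∈Λ k

    ax≈y : (a ▸ (x₀ ∷ x′)) ≈V y
    ax≈y 0F = begin
      a₀₀ * (w * (y 0F + - S)) + S  ≈⟨ +-congʳ (*-assoc _ _ _) ⟨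
      (a₀₀ * w) * (y 0F + - S) + S  ≈⟨ +-congʳ (trans (*-congʳ a₀₀w≈1) (*-identityˡ _)) ⟩
      (y 0F + - S) + S              ≈⟨ +-assoc _ _ _ ⟩
      y 0F + (- S + S)              ≈⟨ +-congˡ (-‿inverseˡ S) ⟩
      y 0F + 0#                     ≈⟨ +-identityʳ _ ⟩
      y 0F                          ∎
    ax≈y (sucF i) =
      trans (+-cong (trans (*-congʳ (a-up (sucF i) 0F (s≤s z≤n))) (zeroˡ _)) (ax′≈y′ i)) (+-identityˡ _)

  backSubstitution : ∀ {n} (cs : Fin n → ΓC → Set) → (∀ i → UpwardClosed (cs i)) → (a : Mat n) →
                     UpperTriangular a → EntrywiseStable cs a → MapsOnto cs a
  backSubstitution {zero}  cs cs-up a a-up stable y y∈Λ = y , y∈Λ , λ ()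
  backSubstitution {suc n} cs cs-up a a-up stable y y∈Λ
    with backSubstitution (cs ∘ sucF) (cs-up ∘ sucF) (lowerRight a)
           (UpperTriangular-lowerRight a-up) (EntrywiseStable-lowerRight stable) (y ∘ sucF) (y∈Λ ∘ sucF)
  ... | x′ , x′∈Λ , ax′≈y′ = solveFirstRow cs (cs-up 0F) a a-up stable y (y∈Λ 0F) x′ x′∈Λ ax′≈y′

  stabiliser : ∀ {n} (cs : Fin n → ΓC → Set) → (∀ i → UpwardClosed (cs i)) → (a : Mat n) → InB n a →
               ActEq a cs ⇔ EntrywiseStable cs a
  stabiliser cs cs-up a (a-up , b , _ , ba≈1) = mk⇔
    (λ aΛ≡Λ → ActEq⇒diag∈Δ cs a-up ba≈1 aΛ≡Λ , λ i j _ → mapsInto⇒colon cs (proj₁ aΛ≡Λ) i j)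
    (λ stable → EntrywiseStable⇒mapsInto cs cs-up a a-up stable , backSubstitution cs cs-up a a-up stable)

open import Defs

mainTheorem11 : (K : ValuedField) → let open ValuedField K in
    (Cut : Set) (C : Cut → ΓC → Set) → (∀ c → UpwardClosed K (C c)) →
    (n : ℕ) (c : Fin n → Cut) (a : Mat K n) → InB K n a →
    ActEq K a (λ i → C (c i))
      ⇔ ((∀ i → _∈Δ_ K (v (a i i)) (C (c i)))
         × (∀ i j → i < j → _∶_ K (I K (C (c i))) (I K (C (c j))) (a i j)))
mainTheorem11 K Cut C C-up n c = Stabiliser.stabiliser K (C ∘ c) (C-up ∘ c)
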